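{- Let $m,n$ be positive integers and let $\mathbf{r},\mathbf{r}'\in\mathbb{Z}^m$ be integer vectors all of whose entries are congruent to $n$ modulo $2$, such that $\mathbf{r}'\succeq\mathbf{r}$. Then $|A_{\mathbf{r}}(m,n)|\ge|A_{\mathbf{r}'}(m,n)|$.
   Context: A $\pm1$ matrix is one with all entries in $\{1,-1\}$. For an $m\times n$ $\pm1$ matrix $M$, its row-sum vector is $(r_1,\dots,r_m)$ where $r_i$ is the sum of the entries in row $i$. A $\pm1$ matrix is column-good if every column sum lies in $\{ -1,0,1\}$. For $\mathbf{r}\in\mathbb{Z}^m$, $A_{\mathbf{r}}(m,n)$ denotes the set of column-good $m\times n$ $\pm1$ matrices with row-sum vector $\mathbf{r}$. For $x,y\in\mathbb{Z}^m$, $x$ majorizes $y$, written $x\succeq y$, if $\sum_{i=1}^m x_i=\sum_{i=1}^m y_i$ and for every $k\in\{1,\dots,m\}$, $\sum_{j=1}^k x_{[j]}\ge\sum_{j=1}^k y_{[j]}$, where $(x_{[1]},\dots,x_{[m]})$ and $(y_{[1]},\dots,y_{[m]})$ are the rearrangements of $x$ and $y$ in nonincreasing order. -}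

module Defs where

open import Data.Nat as ℕ using (ℕ; zero; suc)
open import Data.Integer as ℤ using (ℤ; +_; -[1+_]; ∣_∣)
import Data.Integer.Properties as ℤP
open import Data.Sign using (Sign) renaming (+ to plus; - to minus)
open import Data.Fin using (Fin)
open import Data.Vec as Vec using (Vec; []; _∷_)
open import Data.List as List using (List; []; _∷_)
open import Data.Product using (_×_)
open import Relation.Nullary using (Dec)
open import Relation.Binary.PropositionalEquality using (_≡_)
open import Relation.Nullary.Decidable using (_×-dec_)
open import Data.Vec.Relation.Unary.All as VAll using (All; all?)
import Data.List.Sort as Sort

entry : Sign → ℤ
entry plus  = ℤ.+ 1
entry minus = ℤ.-[1+ 0 ]

Matrix : ℕ → ℕ → Set
Matrix m n = Vec (Vec Sign n) m

vsum : ∀ {k} → Vec ℤ k → ℤ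
vsum = Vec.foldr _ ℤ._+_ (ℤ.+ 0)

rowSum : ∀ {n} → Vec Sign n → ℤ
rowSum row = vsum (Vec.map entry row)

rowSums : ∀ {m n} → Matrix m n → Vec ℤ m
rowSums = Vec.map rowSum

colSums : ∀ {m n} → Matrix m n → Vec ℤ n
colSums M = Vec.map rowSum (Vec.transpose M)

ColumnGood : ∀ {m n} → Matrix m n → Set
ColumnGood M = All (λ c → ∣ c ∣ ℕ.≤ 1) (colSums M)

columnGood? : ∀ {m n} (M : Matrix m n) → Dec (ColumnGood M)
columnGood? M = all? (λ c → ∣ c ∣ ℕ.≤? 1) (colSums M)

InA : ∀ {m n} → Vec ℤ m → Matrix m n → Set
InA r M = ColumnGood M × rowSums M ≡ r

import Data.Vec.Properties as VecP

inA? : ∀ {m n} (r : Vec ℤ m) (M : Matrix m n) → Dec (InA r M)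
inA? r M = columnGood? M ×-dec VecP.≡-dec ℤ._≟_ (rowSums M) r

allVecs : ∀ {A : Set} → List A → (k : ℕ) → List (Vec A k)
allVecs xs zero    = [] ∷ []
allVecs xs (suc k) = List.concatMap (λ x → List.map (x ∷_) (allVecs xs k)) xs

allMatrices : (m n : ℕ) → List (Matrix m n)
allMatrices m n = allVecs (allVecs (plus ∷ minus ∷ []) n) m

cardA : (m n : ℕ) → Vec ℤ m → ℕ
cardA m n r = List.length (List.filter (inA? r) (allMatrices m n))

open Sort ℤP.≤-decTotalOrder using (sort)

sortDesc : ∀ {m} → Vec ℤ m → List ℤ
sortDesc x = List.reverse (sort (Vec.toList x))

lsum : List ℤ → ℤ
lsum = List.foldr ℤ._+_ (ℤ.+ 0)

_≽_ : ∀ {m} → Vec ℤ m → Vec ℤ m → Set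
_≽_ {m} x y =
  vsum x ≡ vsum y ×
  (∀ (k : ℕ) → 1 ℕ.≤ k → k ℕ.≤ m →
     lsum (List.take k (sortDesc y)) ℤ.≤ lsum (List.take k (sortDesc x)))

module Submission where

-- Proof plan.  For r ∈ ℤ^m let A_r be the column-good m × n ±1 matrices with
-- row sums r.  Two operations on r do not decrease |A_r|:
--
--  * card-moveGap: if r_i - r_j ≥ 2(k+1), moving 2(k+1) from r_i to r_j.
--    The injection A_r → A_r′ is transfer: scan rows i and j from the left,
--    exchanging their entries in each column until row i has given exactly
--    2(k+1).  Column sums are kept, and transferring back from row j undoes it.
--  * card-↭: permuting the entries of r, since swapping two rows of the
--    matrices is a bijection and a permutation is a product of swaps.
--
-- For the theorem replace r′ and r by their decreasing rearrangements x and y.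
-- Majorization says every partial surplus Σ_{t≤k} (x_t - y_t) is nonnegative
-- with total 0 (Dominated).  As all entries have the parity of n, while x ≠ y
-- there is a Robin Hood step moving 2 from some x_i to some x_j ≤ x_i - 2 that
-- keeps y dominated and lowers the sum of the partial surpluses (robin-hood);
-- iterating it reaches y (descent), each step being card-moveGap with k = 0.

open import Data.Nat as ℕ using (ℕ; zero; suc; z≤n; s≤s)
import Data.Nat.Properties as ℕP
open import Data.Integer as ℤ using (ℤ; +_; -[1+_]; _+_; _-_; _*_; _≤_; _<_; +≤+)
import Data.Integer.Properties as ℤP
open import Data.Integer.Divisibility using (_∣_)
import Data.Integer.Divisibility.Signed as Signed
open import Data.Integer.Tactic.RingSolver using (solve-∀)
open import Data.Sign using (Sign) renaming (+ to plus; - to minus)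
open import Data.Fin using (Fin)
import Data.Fin.Properties as FinP
open import Data.Product using (Σ; _,_; _×_; proj₁; proj₂)
open import Data.Sum using (_⊎_; inj₁; inj₂)
open import Data.Empty using (⊥; ⊥-elim)
open import Data.Vec as Vec using (Vec; []; _∷_; lookup; _[_]≔_; toList)
import Data.Vec.Properties as VecP
import Data.Vec.Relation.Unary.All as VecAll
import Data.Vec.Relation.Unary.Any as VecAny
import Data.Vec.Relation.Unary.Any.Properties as VecAnyP
open import Data.Vec.Membership.Propositional.Properties using (∈-toList⁻; ∈-toList⁺; ∈-lookup)
open import Data.List as List using (List; []; _∷_; _++_; length)
import Data.List.Properties as ListP
open import Data.List.Membership.Propositional using (_∈_)
open import Data.List.Membership.Propositional.Properties
  using (∈-∃++; ∈-++⁻; ∈-++⁺ˡ; ∈-++⁺ʳ; ∈-map⁻; ∈-map⁺; ∈-filter⁺; ∈-filter⁻)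
open import Data.List.Relation.Unary.Any using (here; there)
open import Data.List.Relation.Unary.All as ListAll using (All; []; _∷_)
open import Data.List.Relation.Unary.AllPairs using (AllPairs; []; _∷_)
import Data.List.Relation.Unary.AllPairs.Properties as AllPairsP
import Data.List.Relation.Unary.Linked.Properties as LinkedP
open import Data.List.Relation.Unary.Unique.Propositional using (Unique)
import Data.List.Relation.Unary.Unique.Propositional.Properties as UniqueP
open import Data.List.Relation.Binary.Permutation.Propositional
  using (_↭_; ↭-refl; ↭-trans; ↭-sym; ↭-prep; ↭-swap; ↭⇒↭ₛ)
import Data.List.Relation.Binary.Permutation.Propositional.Properties as PermP
import Data.List.Relation.Binary.Permutation.Setoid.Properties as PermSetoidP
import Data.List.Sort as Sort
open import Relation.Binary.PropositionalEquality
open import Relation.Nullary using (yes; no)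
open import Defs

open Sort ℤP.≤-decTotalOrder using (sort-↭; sort-↗)

≤-by-difference : ∀ {x y} (d : ℤ) → + 0 ≤ d → y ≡ x + d → x ≤ y
≤-by-difference {x} {y} d 0≤d y≡x+d = begin
  x       ≡⟨ sym (ℤP.+-identityʳ x) ⟩
  x + + 0 ≤⟨ ℤP.+-monoʳ-≤ x 0≤d ⟩
  x + d   ≡⟨ sym y≡x+d ⟩
  y       ∎
  where open ℤP.≤-Reasoning

SameParity : ℕ → ℤ → Set
SameParity n z = + 2 ∣ (z - + n)

parity-gap : ∀ {n a b} → SameParity n a → SameParity n b → b < a → b + + 2 ≤ a
parity-gap {n} {a} {b} pa pb b<a
  with Signed.∣m∣n⇒∣m-n (Signed.∣ᵤ⇒∣ {+ 2} {a - + n} pa) (Signed.∣ᵤ⇒∣ {+ 2} {b - + n} pb)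
... | Signed.divides q eq = begin
  b + + 2       ≤⟨ ℤP.+-monoʳ-≤ b (two≤ q (trans (cancel-n a b (+ n)) eq)) ⟩
  b + (a - b)   ≡⟨ b+[a-b]≡a a b ⟩
  a             ∎
  where
  open ℤP.≤-Reasoning
  cancel-n : ∀ a b n → a - b ≡ (a - n) - (b - n)
  cancel-n = solve-∀
  b+[a-b]≡a : ∀ a b → b + (a - b) ≡ a
  b+[a-b]≡a = solve-∀
  two≤ : ∀ q → a - b ≡ q * + 2 → + 2 ≤ a - b
  two≤ (+ zero)    e = ⊥-elim (ℤP.<⇒≢ b<a (sym (ℤP.i-j≡0⇒i≡j a b e)))
  two≤ (+ suc t)   e = subst (+ 2 ≤_) (sym e) (+≤+ (s≤s (s≤s z≤n)))
  two≤ -[1+ t ]    e with subst (+ 0 ≤_) e (ℤP.i≤j⇒0≤j-i (ℤP.<⇒≤ b<a))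
  ... | ()

sameParity-+2 : ∀ {n z} → SameParity n z → SameParity n (z + + 2)
sameParity-+2 {n} {z} p = Signed.∣⇒∣ᵤ (subst (Signed._∣_ (+ 2)) (regroup z (+ n))
  (Signed.∣m∣n⇒∣m+n (Signed.∣ᵤ⇒∣ {+ 2} {z - + n} p) (Signed.∣-refl {+ 2})))
  where
  regroup : ∀ z n → (z - n) + + 2 ≡ (z + + 2) - n
  regroup = solve-∀

sameParity--2 : ∀ {n z} → SameParity n z → SameParity n (z - + 2)
sameParity--2 {n} {z} p = Signed.∣⇒∣ᵤ (subst (Signed._∣_ (+ 2)) (regroup z (+ n))
  (Signed.∣m∣n⇒∣m-n (Signed.∣ᵤ⇒∣ {+ 2} {z - + n} p) (Signed.∣-refl {+ 2})))
  where
  regroup : ∀ z n → (z - n) - + 2 ≡ (z - + 2) - n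
  regroup = solve-∀

set₂ : ∀ {A : Set} {m} → Vec A m → Fin m → Fin m → A → A → Vec A m
set₂ v i j x y = (v [ i ]≔ x) [ j ]≔ y

module _ {A : Set} {m} {i j : Fin m} where

  set₂-lookupˡ : (v : Vec A m) (x y : A) → i ≢ j → lookup (set₂ v i j x y) i ≡ x
  set₂-lookupˡ v x y i≢j = trans (VecP.lookup∘update′ i≢j (v [ i ]≔ x) y) (VecP.lookup∘update i v x)

  set₂-lookupʳ : (v : Vec A m) (x y : A) → lookup (set₂ v i j x y) j ≡ y
  set₂-lookupʳ v x y = VecP.lookup∘update j (v [ i ]≔ x) y

  set₂-set₂ : (v : Vec A m) (x y x′ y′ : A) → i ≢ j → set₂ (set₂ v i j x y) i j x′ y′ ≡ set₂ v i j x′ y′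
  set₂-set₂ v x y x′ y′ i≢j = begin
    (((v [ i ]≔ x) [ j ]≔ y) [ i ]≔ x′) [ j ]≔ y′
      ≡⟨ cong (_[ j ]≔ y′) (VecP.[]≔-commutes (v [ i ]≔ x) j i (λ j≡i → i≢j (sym j≡i))) ⟩
    (((v [ i ]≔ x) [ i ]≔ x′) [ j ]≔ y) [ j ]≔ y′
      ≡⟨ VecP.[]≔-idempotent ((v [ i ]≔ x) [ i ]≔ x′) j ⟩
    ((v [ i ]≔ x) [ i ]≔ x′) [ j ]≔ y′
      ≡⟨ cong (_[ j ]≔ y′) (VecP.[]≔-idempotent v i) ⟩
    (v [ i ]≔ x′) [ j ]≔ y′ ∎
    where open ≡-Reasoning

  set₂-lookup : (v : Vec A m) → set₂ v i j (lookup v i) (lookup v j) ≡ v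
  set₂-lookup v = trans (cong (_[ j ]≔ lookup v j) (VecP.[]≔-lookup v i)) (VecP.[]≔-lookup v j)

  set₂-comm : (v : Vec A m) (x y : A) → i ≢ j → set₂ v j i y x ≡ set₂ v i j x y
  set₂-comm v x y i≢j = sym (VecP.[]≔-commutes v i j i≢j)

  map-set₂ : ∀ {B : Set} (f : A → B) (v : Vec A m) (x y : A) →
    Vec.map f (set₂ v i j x y) ≡ set₂ (Vec.map f v) i j (f x) (f y)
  map-set₂ f v x y = trans (VecP.map-[]≔ f (v [ i ]≔ x) j) (cong (_[ j ]≔ f y) (VecP.map-[]≔ f v i))

vsum-update : ∀ {m} (v : Vec ℤ m) i x → vsum (v [ i ]≔ x) ≡ vsum v - lookup v i + x
vsum-update (y ∷ v) Fin.zero    x = replace-head x y (vsum v)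
  where
  replace-head : ∀ x y s → x + s ≡ y + s - y + x
  replace-head = solve-∀
vsum-update (y ∷ v) (Fin.suc i) x =
  trans (cong (_+_ y) (vsum-update v i x)) (reassociate y (vsum v) (lookup v i) x)
  where
  reassociate : ∀ y s l x → y + (s - l + x) ≡ y + s - l + x
  reassociate = solve-∀

vsum-set₂ : ∀ {m} (v : Vec ℤ m) {i j} x y → i ≢ j →
  x + y ≡ lookup v i + lookup v j → vsum (set₂ v i j x y) ≡ vsum v
vsum-set₂ v {i} {j} x y i≢j same-total = begin
  vsum (set₂ v i j x y)                                ≡⟨ vsum-update (v [ i ]≔ x) j y ⟩
  vsum (v [ i ]≔ x) - lookup (v [ i ]≔ x) j + y        ≡⟨ cong₂ (λ s l → s - l + y) (vsum-update v i x)
                                                            (VecP.lookup∘update′ (λ j≡i → i≢j (sym j≡i)) v x) ⟩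
  vsum v - lookup v i + x - lookup v j + y             ≡⟨ regroup (vsum v) (lookup v i) (lookup v j) x y ⟩
  vsum v - (lookup v i + lookup v j) + (x + y)         ≡⟨ cong (λ t → vsum v - (lookup v i + lookup v j) + t) same-total ⟩
  vsum v - (lookup v i + lookup v j) + (lookup v i + lookup v j) ≡⟨ cancel (vsum v) (lookup v i + lookup v j) ⟩
  vsum v                                               ∎
  where
  open ≡-Reasoning
  regroup : ∀ s a b x y → s - a + x - b + y ≡ s - (a + b) + (x + y)
  regroup = solve-∀
  cancel : ∀ s t → s - t + t ≡ s
  cancel = solve-∀

swap : ∀ {A : Set} {m} → Vec A m → Fin m → Fin m → Vec A m
swap v i j = set₂ v i j (lookup v j) (lookup v i)

swap-self : ∀ {A : Set} {m} (v : Vec A m) i → swap v i i ≡ v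
swap-self v i = set₂-lookup v

swap-involutive : ∀ {A : Set} {m} (v : Vec A m) i j → swap (swap v i j) i j ≡ v
swap-involutive v i j with i FinP.≟ j
... | yes refl = trans (swap-self (swap v i i) i) (swap-self v i)
... | no i≢j   = begin
  set₂ (swap v i j) i j (lookup (swap v i j) j) (lookup (swap v i j) i)
    ≡⟨ cong₂ (set₂ (swap v i j) i j) (set₂-lookupʳ v _ _) (set₂-lookupˡ v _ _ i≢j) ⟩
  set₂ (swap v i j) i j (lookup v i) (lookup v j)  ≡⟨ set₂-set₂ v _ _ _ _ i≢j ⟩
  set₂ v i j (lookup v i) (lookup v j)             ≡⟨ set₂-lookup v ⟩
  v                                                ∎
  where open ≡-Reasoning

update-preserves : ∀ {A : Set} (P : A → Set) {m} (v : Vec A m) i {x} →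
  (∀ l → P (lookup v l)) → P x → ∀ l → P (lookup (v [ i ]≔ x) l)
update-preserves P (y ∷ v) Fin.zero    all Px Fin.zero    = Px
update-preserves P (y ∷ v) Fin.zero    all Px (Fin.suc l) = all (Fin.suc l)
update-preserves P (y ∷ v) (Fin.suc i) all Px Fin.zero    = all Fin.zero
update-preserves P (y ∷ v) (Fin.suc i) all Px (Fin.suc l) = update-preserves P v i (λ l → all (Fin.suc l)) Px l

-- gap k = 2(k+1), the positive even amounts a row exchange can move.
gap : ℕ → ℤ
gap zero    = + 2
gap (suc k) = gap k + + 2

two≤gap : ∀ k → + 2 ≤ gap k
two≤gap zero    = ℤP.≤-refl
two≤gap (suc k) = ℤP.≤-trans (two≤gap k) (ℤP.i≤i+j (gap k) (+ 2))

Row : ℕ → Set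
Row n = Vec Sign n

consColumn : ∀ {n} → Sign → Sign → Row n × Row n → Row (suc n) × Row (suc n)
consColumn x y rows = (x ∷ proj₁ rows) , (y ∷ proj₂ rows)

-- transfer k a b scans the columns of the rows a (upper) and b (lower) from
-- left to right, exchanging the two entries of every column, and stops right
-- after the column at which a has given exactly gap k to b in total.  The
-- counter k records what a still owes: a (+,-) column pays 2, a (-,+) column
-- adds 2 to the debt, and an equal column is unaffected by the exchange.
transfer : ∀ {n} → ℕ → Row n → Row n → Row n × Row n
payTwo   : ∀ {n} → ℕ → Row n → Row n → Row (suc n) × Row (suc n)
transfer k []          []          = [] , []
transfer k (plus ∷ a)  (minus ∷ b) = payTwo k a b
transfer k (minus ∷ a) (plus ∷ b)  = consColumn plus minus (transfer (suc k) a b)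
transfer k (plus ∷ a)  (plus ∷ b)  = consColumn plus plus (transfer k a b)
transfer k (minus ∷ a) (minus ∷ b) = consColumn minus minus (transfer k a b)

payTwo zero    a b = (minus ∷ a) , (plus ∷ b)
payTwo (suc k) a b = consColumn minus plus (transfer k a b)

transfer-inverse : ∀ {n} k (a b : Row n) →
  transfer k (proj₂ (transfer k a b)) (proj₁ (transfer k a b)) ≡ (b , a)
transfer-inverse k       []          []          = refl
transfer-inverse zero    (plus ∷ a)  (minus ∷ b) = refl
transfer-inverse (suc k) (plus ∷ a)  (minus ∷ b) = cong (consColumn minus plus) (transfer-inverse k a b)
transfer-inverse k       (minus ∷ a) (plus ∷ b)  = cong (consColumn plus minus) (transfer-inverse (suc k) a b)
transfer-inverse k       (plus ∷ a)  (plus ∷ b)  = cong (consColumn plus plus) (transfer-inverse k a b)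
transfer-inverse k       (minus ∷ a) (minus ∷ b) = cong (consColumn minus minus) (transfer-inverse k a b)

ColumnwiseEqual : ∀ {n} → Row n × Row n → Row n × Row n → Set
ColumnwiseEqual {n} (a′ , b′) (a , b) = ∀ (c : Fin n) →
  entry (lookup a′ c) + entry (lookup b′ c) ≡ entry (lookup a c) + entry (lookup b c)

transfer-columns : ∀ {n} k (a b : Row n) → ColumnwiseEqual (transfer k a b) (a , b)
transfer-columns zero    (plus ∷ a)  (minus ∷ b) Fin.zero    = refl
transfer-columns (suc k) (plus ∷ a)  (minus ∷ b) Fin.zero    = refl
transfer-columns zero    (plus ∷ a)  (minus ∷ b) (Fin.suc c) = refl
transfer-columns (suc k) (plus ∷ a)  (minus ∷ b) (Fin.suc c) = transfer-columns k a b c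
transfer-columns k       (minus ∷ a) (plus ∷ b)  Fin.zero    = refl
transfer-columns k       (minus ∷ a) (plus ∷ b)  (Fin.suc c) = transfer-columns (suc k) a b c
transfer-columns k       (plus ∷ a)  (plus ∷ b)  Fin.zero    = refl
transfer-columns k       (plus ∷ a)  (plus ∷ b)  (Fin.suc c) = transfer-columns k a b c
transfer-columns k       (minus ∷ a) (minus ∷ b) Fin.zero    = refl
transfer-columns k       (minus ∷ a) (minus ∷ b) (Fin.suc c) = transfer-columns k a b c

-- Bookkeeping for one exchanged column with entries ex (upper) and ey (lower):
-- the upper row gives ex - ey, so a debt g becomes g' = g - (ex - ey).
exchanged-column : ∀ ex ey A B {g g′ R} → g ≡ (ex - ey) + g′ →
  (g′ ≤ A - B → R ≡ A - g′) → g ≤ (ex + A) - (ey + B) → ey + R ≡ (ex + A) - g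
exchanged-column ex ey A B {g} {g′} {R} refl rest g≤diff =
  trans (cong (_+_ ey) (rest g′≤A-B)) (pay ex ey A g′)
  where
  regroup : ∀ ex ey A B g′ → (ex + A) - (ey + B) - ((ex - ey) + g′) ≡ (A - B) - g′
  regroup = solve-∀
  pay : ∀ ex ey A g′ → ey + (A - g′) ≡ (ex + A) - ((ex - ey) + g′)
  pay = solve-∀
  g′≤A-B : g′ ≤ A - B
  g′≤A-B = ℤP.0≤i-j⇒j≤i (subst (+ 0 ≤_) (regroup ex ey A B g′) (ℤP.i≤j⇒0≤j-i g≤diff))

transfer-rowSum-upper : ∀ {n} k (a b : Row n) → gap k ≤ rowSum a - rowSum b →
  rowSum (proj₁ (transfer k a b)) ≡ rowSum a - gap k
transfer-rowSum-upper k []          []          gap≤0 = ⊥-elim (gap≰0 (two≤gap k) gap≤0)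
  where
  gap≰0 : ∀ {g} → + 2 ≤ g → g ≤ + 0 → ⊥
  gap≰0 2≤g g≤0 with ℤP.≤-trans 2≤g g≤0
  ... | +≤+ ()
transfer-rowSum-upper zero    (plus ∷ a)  (minus ∷ b) _ = pay-last (rowSum a)
  where
  pay-last : ∀ A → -[1+ 0 ] + A ≡ (+ 1 + A) - + 2
  pay-last = solve-∀
transfer-rowSum-upper (suc k) (plus ∷ a)  (minus ∷ b) =
  exchanged-column (entry plus) (entry minus) (rowSum a) (rowSum b)
    (paid (gap k)) (transfer-rowSum-upper k a b)
  where
  paid : ∀ g → g + + 2 ≡ (+ 1 - -[1+ 0 ]) + g
  paid = solve-∀
transfer-rowSum-upper k       (minus ∷ a) (plus ∷ b)  =
  exchanged-column (entry minus) (entry plus) (rowSum a) (rowSum b)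
    (owed (gap k)) (transfer-rowSum-upper (suc k) a b)
  where
  owed : ∀ g → g ≡ (-[1+ 0 ] - + 1) + (g + + 2)
  owed = solve-∀
transfer-rowSum-upper k       (plus ∷ a)  (plus ∷ b)  =
  exchanged-column (entry plus) (entry plus) (rowSum a) (rowSum b)
    (sym (ℤP.+-identityˡ (gap k))) (transfer-rowSum-upper k a b)
transfer-rowSum-upper k       (minus ∷ a) (minus ∷ b) =
  exchanged-column (entry minus) (entry minus) (rowSum a) (rowSum b)
    (sym (ℤP.+-identityˡ (gap k))) (transfer-rowSum-upper k a b)

columnwise-rowSums : ∀ {n} (a′ b′ a b : Row n) → ColumnwiseEqual (a′ , b′) (a , b) →
  rowSum a′ + rowSum b′ ≡ rowSum a + rowSum b
columnwise-rowSums []        []        []       []       _    = refl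
columnwise-rowSums (x′ ∷ a′) (y′ ∷ b′) (x ∷ a) (y ∷ b) same = begin
  (entry x′ + rowSum a′) + (entry y′ + rowSum b′) ≡⟨ interchange (entry x′) (rowSum a′) (entry y′) (rowSum b′) ⟩
  (entry x′ + entry y′) + (rowSum a′ + rowSum b′) ≡⟨ cong₂ _+_ (same Fin.zero) (columnwise-rowSums a′ b′ a b (λ c → same (Fin.suc c))) ⟩
  (entry x + entry y) + (rowSum a + rowSum b)     ≡⟨ sym (interchange (entry x) (rowSum a) (entry y) (rowSum b)) ⟩
  (entry x + rowSum a) + (entry y + rowSum b)     ∎
  where
  open ≡-Reasoning
  interchange : ∀ p q r s → (p + q) + (r + s) ≡ (p + r) + (q + s)
  interchange = solve-∀

transfer-rowSum-lower : ∀ {n} k (a b : Row n) → gap k ≤ rowSum a - rowSum b →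
  rowSum (proj₂ (transfer k a b)) ≡ rowSum b + gap k
transfer-rowSum-lower k a b gap≤ =
  compensate (rowSum a) (rowSum b) (rowSum a′) (rowSum b′) (gap k)
    (transfer-rowSum-upper k a b gap≤) (columnwise-rowSums a′ b′ a b (transfer-columns k a b))
  where
  a′ = proj₁ (transfer k a b)
  b′ = proj₂ (transfer k a b)
  compensate : ∀ A B A′ B′ g → A′ ≡ A - g → A′ + B′ ≡ A + B → B′ ≡ B + g
  compensate A B A′ B′ g refl total = begin
    B′                     ≡⟨ isolate A g B′ ⟩
    ((A - g) + B′) - A + g ≡⟨ cong (λ t → t - A + g) total ⟩
    (A + B) - A + g        ≡⟨ cancel A B g ⟩
    B + g                  ∎
    where
    open ≡-Reasoning
    isolate : ∀ A g B′ → B′ ≡ ((A - g) + B′) - A + g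
    isolate = solve-∀
    cancel : ∀ A B g → (A + B) - A + g ≡ B + g
    cancel = solve-∀

column : ∀ {m n} → Matrix m n → Fin n → Vec ℤ m
column M c = Vec.map (λ row → entry (lookup row c)) M

lookup-transpose : ∀ {A : Set} {m n} (M : Vec (Vec A n) m) c →
  lookup (Vec.transpose M) c ≡ Vec.map (λ row → lookup row c) M
lookup-transpose {n = n} []      c = VecP.lookup-replicate c []
lookup-transpose {n = n} (a ∷ M) c = begin
  lookup (Vec.replicate n Vec._∷_ Vec.⊛ a Vec.⊛ Vec.transpose M) c
    ≡⟨ VecP.lookup-⊛ c (Vec.replicate n Vec._∷_ Vec.⊛ a) (Vec.transpose M) ⟩
  lookup (Vec.replicate n Vec._∷_ Vec.⊛ a) c (lookup (Vec.transpose M) c)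
    ≡⟨ cong (λ f → f (lookup (Vec.transpose M) c)) (VecP.lookup-⊛ c (Vec.replicate n Vec._∷_) a) ⟩
  lookup (Vec.replicate n Vec._∷_) c (lookup a c) (lookup (Vec.transpose M) c)
    ≡⟨ cong (λ f → f (lookup a c) (lookup (Vec.transpose M) c)) (VecP.lookup-replicate c Vec._∷_) ⟩
  lookup a c ∷ lookup (Vec.transpose M) c
    ≡⟨ cong (lookup a c ∷_) (lookup-transpose M c) ⟩
  lookup a c ∷ Vec.map (λ row → lookup row c) M ∎
  where open ≡-Reasoning

colSums-lookup : ∀ {m n} (M : Matrix m n) c → lookup (colSums M) c ≡ vsum (column M c)
colSums-lookup M c = begin
  lookup (Vec.map rowSum (Vec.transpose M)) c             ≡⟨ VecP.lookup-map c rowSum (Vec.transpose M) ⟩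
  rowSum (lookup (Vec.transpose M) c)                     ≡⟨ cong rowSum (lookup-transpose M c) ⟩
  vsum (Vec.map entry (Vec.map (λ row → lookup row c) M)) ≡⟨ cong vsum (sym (VecP.map-∘ entry (λ row → lookup row c) M)) ⟩
  vsum (column M c)                                       ∎
  where open ≡-Reasoning

set₂-colSums : ∀ {m n} (M : Matrix m n) {i j} (a′ b′ : Vec Sign n) → i ≢ j →
  ColumnwiseEqual (a′ , b′) (lookup M i , lookup M j) → colSums (set₂ M i j a′ b′) ≡ colSums M
set₂-colSums M {i} {j} a′ b′ i≢j same = begin
  colSums M′                               ≡⟨ sym (VecP.tabulate∘lookup (colSums M′)) ⟩
  Vec.tabulate (lookup (colSums M′))       ≡⟨ VecP.tabulate-cong same-column-sum ⟩
  Vec.tabulate (lookup (colSums M))        ≡⟨ VecP.tabulate∘lookup (colSums M) ⟩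
  colSums M                                ∎
  where
  open ≡-Reasoning
  M′ = set₂ M i j a′ b′
  same-column-sum : ∀ c → lookup (colSums M′) c ≡ lookup (colSums M) c
  same-column-sum c = begin
    lookup (colSums M′) c                                          ≡⟨ colSums-lookup M′ c ⟩
    vsum (column M′ c)                                             ≡⟨ cong vsum (map-set₂ f M a′ b′) ⟩
    vsum (set₂ (column M c) i j (f a′) (f b′))                     ≡⟨ vsum-set₂ (column M c) (f a′) (f b′) i≢j
                                                                        (trans (same c) (sym (cong₂ _+_ (VecP.lookup-map i f M) (VecP.lookup-map j f M)))) ⟩
    vsum (column M c)                                              ≡⟨ sym (colSums-lookup M c) ⟩
    lookup (colSums M) c                                           ∎
    where
    f : Vec Sign _ → ℤ
    f row = entry (lookup row c)

unique-⊆⇒length-≤ : ∀ {A : Set} (xs ys : List A) → Unique xs → (∀ {v} → v ∈ xs → v ∈ ys) →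
  length xs ℕ.≤ length ys
unique-⊆⇒length-≤ []       ys _              _   = z≤n
unique-⊆⇒length-≤ (x ∷ xs) ys (x∉xs ∷ uniq) xs⊆ys with ∈-∃++ (xs⊆ys (here refl))
... | as , bs , refl = begin
  suc (length xs)          ≤⟨ s≤s (unique-⊆⇒length-≤ xs (as ++ bs) uniq xs⊆as++bs) ⟩
  suc (length (as ++ bs))  ≡⟨ sym (ListP.length-++-sucʳ as x bs) ⟩
  length (as ++ x ∷ bs)    ∎
  where
  open ℕP.≤-Reasoning
  xs⊆as++bs : ∀ {v} → v ∈ xs → v ∈ as ++ bs
  xs⊆as++bs v∈xs with ∈-++⁻ as (xs⊆ys (there v∈xs))
  ... | inj₁ v∈as          = ∈-++⁺ˡ v∈as
  ... | inj₂ (here refl)   = ⊥-elim (UniqueP.Unique[x∷xs]⇒x∉xs (x∉xs ∷ uniq) v∈xs)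
  ... | inj₂ (there v∈bs)  = ∈-++⁺ʳ as v∈bs

module _ {A : Set} where

  consAll : ∀ {k} → List (Vec A k) → List A → List (Vec A (suc k))
  consAll L xs = List.concatMap (λ x → List.map (x ∷_) L) xs

  consAll-head : ∀ {k} (L : List (Vec A k)) xs {v} → v ∈ consAll L xs → Vec.head v ∈ xs
  consAll-head L (x ∷ xs) v∈ with ∈-++⁻ (List.map (x ∷_) L) v∈
  ... | inj₁ v∈x∷L with ∈-map⁻ (x ∷_) v∈x∷L
  ...   | _ , _ , refl = here refl
  consAll-head L (x ∷ xs) v∈ | inj₂ v∈rest = there (consAll-head L xs v∈rest)

  consAll-unique : ∀ {k} (L : List (Vec A k)) xs → Unique L → Unique xs → Unique (consAll L xs)
  consAll-unique L []       _     _              = []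
  consAll-unique L (x ∷ xs) uniqL (x∉xs ∷ uniqxs) =
    UniqueP.++⁺ (UniqueP.map⁺ VecP.∷-injectiveʳ uniqL) (consAll-unique L xs uniqL uniqxs) disjoint
    where
    disjoint : ∀ {v} → v ∈ List.map (x ∷_) L × v ∈ consAll L xs → ⊥
    disjoint (v∈x∷L , v∈rest) with ∈-map⁻ (x ∷_) v∈x∷L
    ... | _ , _ , refl = UniqueP.Unique[x∷xs]⇒x∉xs (x∉xs ∷ uniqxs) (consAll-head L xs v∈rest)

  consAll-complete : ∀ {k} (L : List (Vec A k)) xs {y w} → y ∈ xs → w ∈ L → (y ∷ w) ∈ consAll L xs
  consAll-complete L (x ∷ xs) (here refl) w∈L = ∈-++⁺ˡ (∈-map⁺ (x ∷_) w∈L)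
  consAll-complete L (x ∷ xs) (there y∈xs) w∈L = ∈-++⁺ʳ (List.map (x ∷_) L) (consAll-complete L xs y∈xs w∈L)

  allVecs-unique : ∀ (xs : List A) k → Unique xs → Unique (allVecs xs k)
  allVecs-unique xs zero    _    = ListAll.[] ∷ []
  allVecs-unique xs (suc k) uniq = consAll-unique (allVecs xs k) xs (allVecs-unique xs k uniq) uniq

  allVecs-complete : ∀ (xs : List A) k → (∀ x → x ∈ xs) → (v : Vec A k) → v ∈ allVecs xs k
  allVecs-complete xs zero    _   []      = here refl
  allVecs-complete xs (suc k) all (x ∷ v) = consAll-complete (allVecs xs k) xs (all x) (allVecs-complete xs k all v)

allMatrices-unique : ∀ m n → Unique (allMatrices m n)
allMatrices-unique m n = allVecs-unique _ m (allVecs-unique _ n signs-unique)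
  where
  signs-unique : Unique (plus ∷ minus ∷ [])
  signs-unique = ((λ ()) ListAll.∷ ListAll.[]) ∷ ListAll.[] ∷ []

allMatrices-complete : ∀ m n (M : Matrix m n) → M ∈ allMatrices m n
allMatrices-complete m n = allVecs-complete _ m (allVecs-complete _ n every-sign)
  where
  every-sign : ∀ x → x ∈ plus ∷ minus ∷ []
  every-sign plus  = here refl
  every-sign minus = there (here refl)

card-≤-by-injection : ∀ {m n} (r r′ : Vec ℤ m) (F G : Matrix m n → Matrix m n) →
  (∀ M → G (F M) ≡ M) → (∀ M → InA r M → InA r′ (F M)) → cardA m n r ℕ.≤ cardA m n r′
card-≤-by-injection {m} {n} r r′ F G G∘F≡id F-maps = begin
  cardA m n r                                ≡⟨ sym (ListP.length-map F Ar) ⟩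
  length (List.map F Ar)                     ≤⟨ unique-⊆⇒length-≤ (List.map F Ar) Ar′ F[Ar]-unique F[Ar]⊆Ar′ ⟩
  cardA m n r′                               ∎
  where
  open ℕP.≤-Reasoning
  Ar  = List.filter (inA? r) (allMatrices m n)
  Ar′ = List.filter (inA? r′) (allMatrices m n)
  F-injective : ∀ {M N} → F M ≡ F N → M ≡ N
  F-injective {M} {N} FM≡FN = trans (sym (G∘F≡id M)) (trans (cong G FM≡FN) (G∘F≡id N))
  F[Ar]-unique : Unique (List.map F Ar)
  F[Ar]-unique = UniqueP.map⁺ F-injective (UniqueP.filter⁺ (inA? r) (allMatrices-unique m n))
  F[Ar]⊆Ar′ : ∀ {N} → N ∈ List.map F Ar → N ∈ Ar′
  F[Ar]⊆Ar′ N∈ with ∈-map⁻ F N∈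
  ... | M , M∈Ar , refl = ∈-filter⁺ (inA? r′) (allMatrices-complete m n (F M))
                            (F-maps M (proj₂ (∈-filter⁻ (inA? r) {xs = allMatrices m n} M∈Ar)))

moveGap : ∀ {m} → Vec ℤ m → Fin m → Fin m → ℕ → Vec ℤ m
moveGap r i j k = set₂ r i j (lookup r i - gap k) (lookup r j + gap k)

transferRows : ∀ {m n} → Fin m → Fin m → ℕ → Matrix m n → Matrix m n
transferRows i j k M = set₂ M i j (proj₁ moved) (proj₂ moved)
  where moved = transfer k (lookup M i) (lookup M j)

transferRows-inverse : ∀ {m n} {i j : Fin m} k → i ≢ j → (M : Matrix m n) →
  transferRows j i k (transferRows i j k M) ≡ M
transferRows-inverse {i = i} {j} k i≢j M = begin
  set₂ M′ j i (proj₁ (transfer k (lookup M′ j) (lookup M′ i))) (proj₂ (transfer k (lookup M′ j) (lookup M′ i)))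
    ≡⟨ cong (λ rows → set₂ M′ j i (proj₁ rows) (proj₂ rows))
         (trans (cong₂ (transfer k) (set₂-lookupʳ M a′ b′) (set₂-lookupˡ M a′ b′ i≢j)) (transfer-inverse k a b)) ⟩
  set₂ M′ j i b a  ≡⟨ set₂-comm M′ a b i≢j ⟩
  set₂ M′ i j a b  ≡⟨ set₂-set₂ M a′ b′ a b i≢j ⟩
  set₂ M i j a b   ≡⟨ set₂-lookup M ⟩
  M                ∎
  where
  open ≡-Reasoning
  a  = lookup M i
  b  = lookup M j
  a′ = proj₁ (transfer k a b)
  b′ = proj₂ (transfer k a b)
  M′ = transferRows i j k M

transferRows-inA : ∀ {m n} {i j : Fin m} k (r : Vec ℤ m) (M : Matrix m n) → i ≢ j →
  gap k ≤ lookup r i - lookup r j → InA r M → InA (moveGap r i j k) (transferRows i j k M)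
transferRows-inA {i = i} {j} k .(rowSums M) M i≢j gap≤ (good , refl) =
  subst (VecAll.All _) (sym (set₂-colSums M a′ b′ i≢j (transfer-columns k a b))) good , new-rowSums
  where
  a  = lookup M i
  b  = lookup M j
  a′ = proj₁ (transfer k a b)
  b′ = proj₂ (transfer k a b)
  rowSum-a : lookup (rowSums M) i ≡ rowSum a
  rowSum-a = VecP.lookup-map i rowSum M
  rowSum-b : lookup (rowSums M) j ≡ rowSum b
  rowSum-b = VecP.lookup-map j rowSum M
  gap≤a-b : gap k ≤ rowSum a - rowSum b
  gap≤a-b = subst₂ (λ p q → gap k ≤ p - q) rowSum-a rowSum-b gap≤
  new-rowSums : rowSums (transferRows i j k M) ≡ moveGap (rowSums M) i j k
  new-rowSums = begin
    Vec.map rowSum (set₂ M i j a′ b′)               ≡⟨ map-set₂ rowSum M a′ b′ ⟩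
    set₂ (rowSums M) i j (rowSum a′) (rowSum b′)   ≡⟨ cong₂ (set₂ (rowSums M) i j)
                                                        (trans (transfer-rowSum-upper k a b gap≤a-b) (cong (_- gap k) (sym rowSum-a)))
                                                        (trans (transfer-rowSum-lower k a b gap≤a-b) (cong (_+ gap k) (sym rowSum-b))) ⟩
    moveGap (rowSums M) i j k                      ∎
    where open ≡-Reasoning

card-moveGap : ∀ {m n} (r : Vec ℤ m) {i j : Fin m} k → i ≢ j → gap k ≤ lookup r i - lookup r j →
  cardA m n r ℕ.≤ cardA m n (moveGap r i j k)
card-moveGap r {i} {j} k i≢j gap≤ =
  card-≤-by-injection r (moveGap r i j k) (transferRows i j k) (transferRows j i k)
    (transferRows-inverse k i≢j) (λ M → transferRows-inA k r M i≢j gap≤)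

swap-inA : ∀ {m n} (r : Vec ℤ m) (M : Matrix m n) {i j} → i ≢ j → InA r M → InA (swap r i j) (swap M i j)
swap-inA .(rowSums M) M {i} {j} i≢j (good , refl) =
  subst (VecAll.All _) (sym (set₂-colSums M (lookup M j) (lookup M i) i≢j same-columns)) good ,
  trans (map-set₂ rowSum M (lookup M j) (lookup M i))
        (sym (cong₂ (set₂ (rowSums M) i j) (VecP.lookup-map j rowSum M) (VecP.lookup-map i rowSum M)))
  where
  same-columns : ColumnwiseEqual (lookup M j , lookup M i) (lookup M i , lookup M j)
  same-columns c = ℤP.+-comm (entry (lookup (lookup M j) c)) (entry (lookup (lookup M i) c))

card-swap : ∀ {m n} (r : Vec ℤ m) i j → cardA m n r ≡ cardA m n (swap r i j)
card-swap {m} {n} r i j with i FinP.≟ j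
... | yes refl = cong (cardA m n) (sym (swap-self r i))
... | no i≢j   = ℕP.≤-antisym (swap-≤ r) (subst (λ s → cardA m n (swap r i j) ℕ.≤ cardA m n s)
                                              (swap-involutive r i j) (swap-≤ (swap r i j)))
  where
  swap-≤ : ∀ s → cardA m n s ℕ.≤ cardA m n (swap s i j)
  swap-≤ s = card-≤-by-injection s (swap s i j) (λ M → swap M i j) (λ M → swap M i j)
               (λ M → swap-involutive M i j) (λ M → swap-inA s M i≢j)

module _ {A : Set} where

  data Swaps {m} : Vec A m → Vec A m → Set where
    done      : ∀ {u} → Swaps u u
    swap-then : ∀ {u v} i j → Swaps (swap u i j) v → Swaps u v

  Swaps-trans : ∀ {m} {u v w : Vec A m} → Swaps u v → Swaps v w → Swaps u w
  Swaps-trans done              q = q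
  Swaps-trans (swap-then i j p) q = swap-then i j (Swaps-trans p q)

  Swaps-cons : ∀ {m} a {u v : Vec A m} → Swaps u v → Swaps (a ∷ u) (a ∷ v)
  Swaps-cons a done              = done
  Swaps-cons a (swap-then i j p) = swap-then (Fin.suc i) (Fin.suc j) (Swaps-cons a p)

  exchange-↭ : ∀ {m} (w : Vec A m) j b → lookup w j ∷ toList (w [ j ]≔ b) ↭ b ∷ toList w
  exchange-↭ (c ∷ w) Fin.zero    b = ↭-swap c b ↭-refl
  exchange-↭ (c ∷ w) (Fin.suc j) b =
    ↭-trans (↭-swap (lookup w j) c ↭-refl) (↭-trans (↭-prep c (exchange-↭ w j b)) (↭-swap c b ↭-refl))

  -- Vectors with permuted entries are connected by swaps (selection sort).
  ↭⇒Swaps : ∀ {m} (u v : Vec A m) → toList u ↭ toList v → Swaps u v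
  ↭⇒Swaps []      []      _ = done
  ↭⇒Swaps (a ∷ u) (b ∷ v) p with ∈-toList⁻ {xs = b ∷ v} (PermP.∈-resp-↭ p (here refl))
  ... | a∈bv with VecAny.index a∈bv | VecAnyP.lookup-index a∈bv
  ...   | Fin.zero  | refl = Swaps-cons a (↭⇒Swaps u v (PermP.drop-∷ p))
  ...   | Fin.suc j | refl =
    Swaps-trans (Swaps-cons a (↭⇒Swaps u (v [ j ]≔ b) (PermP.drop-∷ (↭-trans p (↭-sym (exchange-↭ v j b))))))
                (swap-then Fin.zero (Fin.suc j) (subst (λ w → Swaps w (b ∷ v)) (sym (swap-involutive (b ∷ v) Fin.zero (Fin.suc j))) done))

card-↭ : ∀ {m n} (u v : Vec ℤ m) → toList u ↭ toList v → cardA m n u ≡ cardA m n v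
card-↭ {m} {n} u v p = along (↭⇒Swaps u v p)
  where
  along : ∀ {u v} → Swaps u v → cardA m n u ≡ cardA m n v
  along done              = refl
  along (swap-then i j s) = trans (card-swap _ i j) (along s)

AllSameParity : ℕ → ∀ {m} → Vec ℤ m → Set
AllSameParity n x = ∀ i → SameParity n (lookup x i)

moveGap-parity : ∀ {n m} (x : Vec ℤ m) i j → AllSameParity n x → AllSameParity n (moveGap x i j 0)
moveGap-parity {n} x i j px =
  update-preserves (SameParity n) (x [ i ]≔ (lookup x i - + 2)) j
    (update-preserves (SameParity n) x i px (sameParity--2 {n} {lookup x i} (px i)))
    (sameParity-+2 {n} {lookup x j} (px j))

-- Dominated c x y: starting with surplus c and adding x_t - y_t entry by entry,
-- every partial surplus is nonnegative and the final surplus is 0.  With c = 0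
-- this is majorization of y by x, read in the order of the entries.
Dominated : ∀ {m} → ℤ → Vec ℤ m → Vec ℤ m → Set
Dominated c []      []      = c ≡ + 0
Dominated c (a ∷ x) (b ∷ y) = + 0 ≤ c + (a - b) × Dominated (c + (a - b)) x y

potential : ∀ {m} → ℤ → Vec ℤ m → Vec ℤ m → ℕ
potential c []      []      = 0
potential c (a ∷ x) (b ∷ y) = ℤ.∣ c + (a - b) ∣ ℕ.+ potential (c + (a - b)) x y

Nonincreasing : ∀ {m} → Vec ℤ m → Set
Nonincreasing y = AllPairs (λ u v → v ≤ u) (toList y)

∣c-2∣+2≡∣c∣ : ∀ c → + 2 ≤ c → ℤ.∣ c - + 2 ∣ ℕ.+ 2 ≡ ℤ.∣ c ∣
∣c-2∣+2≡∣c∣ (+ suc (suc t)) (+≤+ (ℕ.s≤s (ℕ.s≤s _))) = ℕP.+-comm t 2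

∣c-2∣<∣c∣ : ∀ c → + 2 ≤ c → ℤ.∣ c - + 2 ∣ ℕ.< ℤ.∣ c ∣
∣c-2∣<∣c∣ c 2≤c = begin-strict
  ℤ.∣ c - + 2 ∣          <⟨ ℕP.m<m+n _ (ℕ.s≤s ℕ.z≤n) ⟩
  ℤ.∣ c - + 2 ∣ ℕ.+ 2    ≡⟨ ∣c-2∣+2≡∣c∣ c 2≤c ⟩
  ℤ.∣ c ∣                ∎
  where open ℕP.≤-Reasoning

+2≤⇒2≤- : ∀ {u v} → u + + 2 ≤ v → + 2 ≤ v - u
+2≤⇒2≤- {u} {v} u+2≤v =
  ℤP.0≤i-j⇒j≤i (subst (+ 0 ≤_) (regroup u v) (ℤP.i≤j⇒0≤j-i u+2≤v))
  where
  regroup : ∀ u v → v - (u + + 2) ≡ (v - u) - + 2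
  regroup = solve-∀

surplus-grows : ∀ {c a b} → + 2 ≤ c → b ≤ a → + 2 ≤ c + (a - b)
surplus-grows {c} {a} {b} 2≤c b≤a = ℤP.≤-trans 2≤c (≤-by-difference (a - b) (ℤP.i≤j⇒0≤j-i b≤a) refl)

raise : ∀ {m} → Vec ℤ m → Fin m → Vec ℤ m
raise x j = x [ j ]≔ (lookup x j + + 2)

-- With surplus c ≥ 2 still to be used up, some later entry x_j lies strictly
-- below y_j; the first such one satisfies x_j + 2 ≤ y_j ≤ b by parity.
find-deficit : ∀ {m n} (c b : ℤ) (x y : Vec ℤ m) → + 2 ≤ c → Dominated c x y →
  AllSameParity n x → AllSameParity n y → All (λ z → z ≤ b) (toList y) →
  Σ (Fin m) λ j → lookup x j + + 2 ≤ b × Dominated (c - + 2) (raise x j) y ×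
                  potential (c - + 2) (raise x j) y ℕ.≤ potential c x y
find-deficit c b [] [] 2≤c refl _ _ _ with 2≤c
... | +≤+ ()
find-deficit c b (a ∷ x) (b′ ∷ y) 2≤c (0≤s , dom) px py (b′≤b ∷ y≤b) with b′ ℤ.≤? a
... | no b′≰a = Fin.zero , ℤP.≤-trans a+2≤b′ b′≤b , subst Unchanged (sym (same-surplus c a b′)) ((0≤s , dom) , ℕP.≤-refl)
  where
  -- x_0 < y_0, and raising x_0 leaves the surplus after it unchanged
  a+2≤b′ : a + + 2 ≤ b′
  a+2≤b′ = parity-gap (py Fin.zero) (px Fin.zero) (ℤP.≰⇒> b′≰a)
  same-surplus : ∀ c a b′ → (c - + 2) + ((a + + 2) - b′) ≡ c + (a - b′)
  same-surplus = solve-∀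
  Unchanged : ℤ → Set
  Unchanged s = (+ 0 ≤ s × Dominated s x y) × ℤ.∣ s ∣ ℕ.+ potential s x y ℕ.≤ potential c (a ∷ x) (b′ ∷ y)
... | yes b′≤a
  with find-deficit (c + (a - b′)) b x y (surplus-grows 2≤c b′≤a) dom (λ i → px (Fin.suc i)) (λ i → py (Fin.suc i)) y≤b
... | j , x_j+2≤b , dom′ , potential≤ =
  Fin.suc j , x_j+2≤b , subst Lowered (sym (shifted-surplus c a b′)) ((0≤c′-2 , dom′) , smaller)
  where
  -- x_0 ≥ y_0: the deficit lies further on, every surplus in between drops by 2
  c′ = c + (a - b′)
  2≤c′ : + 2 ≤ c′
  2≤c′ = surplus-grows 2≤c b′≤a
  0≤c′-2 : + 0 ≤ c′ - + 2
  0≤c′-2 = ℤP.i≤j⇒0≤j-i 2≤c′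
  shifted-surplus : ∀ c a b′ → (c - + 2) + (a - b′) ≡ (c + (a - b′)) - + 2
  shifted-surplus = solve-∀
  Lowered : ℤ → Set
  Lowered s = (+ 0 ≤ s × Dominated s (raise x j) y) ×
              ℤ.∣ s ∣ ℕ.+ potential s (raise x j) y ℕ.≤ potential c (a ∷ x) (b′ ∷ y)
  smaller : ℤ.∣ c′ - + 2 ∣ ℕ.+ potential (c′ - + 2) (raise x j) y ℕ.≤ ℤ.∣ c′ ∣ ℕ.+ potential c′ x y
  smaller = ℕP.+-mono-≤ (ℕP.<⇒≤ (∣c-2∣<∣c∣ c′ 2≤c′)) potential≤

-- At the first index where x and y differ (surplus 0 before it), x_i ≥ y_i + 2.
first-difference-gap : ∀ {n a b} → SameParity n a → SameParity n b → + 0 ≤ + 0 + (a - b) → a ≢ b → b + + 2 ≤ a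
first-difference-gap pa pb 0≤s a≢b =
  parity-gap pa pb (ℤP.≤∧≢⇒< (ℤP.0≤i-j⇒j≤i (subst (+ 0 ≤_) (ℤP.+-identityˡ _) 0≤s)) (λ b≡a → a≢b (sym b≡a)))

surplus≥2 : ∀ {n a b} → SameParity n a → SameParity n b → + 0 ≤ + 0 + (a - b) → a ≢ b → + 2 ≤ + 0 + (a - b)
surplus≥2 pa pb 0≤s a≢b = subst (+ 2 ≤_) (sym (ℤP.+-identityˡ _)) (+2≤⇒2≤- (first-difference-gap pa pb 0≤s a≢b))

no-surplus : ∀ a → + 0 + (a - a) ≡ + 0
no-surplus a = trans (ℤP.+-identityˡ (a - a)) (ℤP.+-inverseʳ a)

record RobinHood {m} (x y : Vec ℤ m) : Set where
  field
    i j       : Fin m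
    distinct  : i ≢ j
    apart     : gap 0 ≤ lookup x i - lookup x j
    dominated : Dominated (+ 0) (moveGap x i j 0) y
    decreases : potential (+ 0) (moveGap x i j 0) y ℕ.< potential (+ 0) x y

-- Unless x = y, a Robin Hood step exists: at the first index where x and y
-- differ we have x_i > y_i, hence x_i ≥ y_i + 2, and find-deficit supplies j.
robin-hood : ∀ {m n} (x y : Vec ℤ m) → Dominated (+ 0) x y →
  AllSameParity n x → AllSameParity n y → Nonincreasing y → x ≡ y ⊎ RobinHood x y
robin-hood []      []      _           _  _  _                 = inj₁ refl
robin-hood (a ∷ x) (b ∷ y) (0≤s , dom) px py (y≤b ∷ y-noninc) with a ℤ.≟ b
... | yes refl with robin-hood x y (subst (λ s → Dominated s x y) (no-surplus a) dom)
                      (λ i → px (Fin.suc i)) (λ i → py (Fin.suc i)) y-noninc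
...   | inj₁ x≡y  = inj₁ (cong (a ∷_) x≡y)
...   | inj₂ step = inj₂ (record
  { i = Fin.suc i ; j = Fin.suc j ; distinct = λ si≡sj → distinct (FinP.suc-injective si≡sj) ; apart = apart
  ; dominated = 0≤s , subst (λ s → Dominated s (moveGap x i j 0) y) (sym (no-surplus a)) dominated
  ; decreases = subst (λ s → ℤ.∣ s ∣ ℕ.+ potential s (moveGap x i j 0) y ℕ.< ℤ.∣ s ∣ ℕ.+ potential s x y)
                      (sym (no-surplus a)) decreases })
  where open RobinHood step
robin-hood (a ∷ x) (b ∷ y) (0≤s , dom) px py (y≤b ∷ y-noninc) | no a≢b
  with find-deficit (+ 0 + (a - b)) b x y (surplus≥2 (px Fin.zero) (py Fin.zero) 0≤s a≢b) dom
         (λ i → px (Fin.suc i)) (λ i → py (Fin.suc i)) y≤b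
... | j , x_j+2≤b , dom′ , potential≤ = inj₂ (record
  { i = Fin.zero ; j = Fin.suc j ; distinct = λ () ; apart = +2≤⇒2≤- x_j+2≤a
  ; dominated = subst (λ s → + 0 ≤ s × Dominated s (raise x j) y) (sym lowered) (ℤP.i≤j⇒0≤j-i 2≤s , dom′)
  ; decreases = subst (λ s → ℤ.∣ s ∣ ℕ.+ potential s (raise x j) y ℕ.< ℤ.∣ c ∣ ℕ.+ potential c x y)
                      (sym lowered) (ℕP.+-mono-<-≤ (∣c-2∣<∣c∣ c 2≤s) potential≤) })
  where
  c = + 0 + (a - b)
  2≤s : + 2 ≤ c
  2≤s = surplus≥2 (px Fin.zero) (py Fin.zero) 0≤s a≢b
  x_j+2≤a : lookup x j + + 2 ≤ a
  x_j+2≤a = ℤP.≤-trans x_j+2≤b (ℤP.≤-trans (ℤP.i≤i+j b (+ 2)) (first-difference-gap (px Fin.zero) (py Fin.zero) 0≤s a≢b))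
  lowered : + 0 + ((a - + 2) - b) ≡ c - + 2
  lowered = regroup a b
    where
    regroup : ∀ a b → + 0 + ((a - + 2) - b) ≡ (+ 0 + (a - b)) - + 2
    regroup = solve-∀

descent : ∀ {m n} (bound : ℕ) (x y : Vec ℤ m) → potential (+ 0) x y ℕ.< bound → Dominated (+ 0) x y →
  AllSameParity n x → AllSameParity n y → Nonincreasing y → cardA m n x ℕ.≤ cardA m n y
descent zero _ _ () _ _ _ _
descent {m} {n} (suc bound) x y below dom px py y-noninc with robin-hood x y dom px py y-noninc
... | inj₁ refl = ℕP.≤-refl
... | inj₂ step = ℕP.≤-trans (card-moveGap x 0 distinct apart)
                    (descent bound (moveGap x i j 0) y (ℕP.<-≤-trans decreases (ℕP.≤-pred below)) dominated
                       (moveGap-parity x i j px) py y-noninc)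
  where open RobinHood step

lsum-↭ : ∀ {xs ys} → xs ↭ ys → lsum xs ≡ lsum ys
lsum-↭ p = PermSetoidP.foldr-commMonoid (setoid ℤ) ℤP.+-0-isCommutativeMonoid (↭⇒↭ₛ p)

vsum≡lsum : ∀ {m} (v : Vec ℤ m) → vsum v ≡ lsum (toList v)
vsum≡lsum []      = refl
vsum≡lsum (a ∷ v) = cong (_+_ a) (vsum≡lsum v)

AllPairs-reverse : ∀ {A : Set} {R : A → A → Set} {xs : List A} →
  AllPairs R xs → AllPairs (λ u v → R v u) (List.reverse xs)
AllPairs-reverse {xs = []}     []          = []
AllPairs-reverse {xs = x ∷ xs} (Rx ∷ Rxs) =
  subst (AllPairs _) (sym (ListP.unfold-reverse x xs))
    (AllPairsP.++⁺ (AllPairs-reverse Rxs) ([] ∷ [])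
      (ListAll.map (λ r → r ∷ []) (PermP.All-resp-↭ (↭-sym (PermP.↭-reverse xs)) Rx)))

listToVec : ∀ {A : Set} (L : List A) m → length L ≡ m → Σ (Vec A m) λ X → toList X ≡ L
listToVec []      zero    _ = [] , refl
listToVec (a ∷ L) (suc m) e with listToVec L m (ℕP.suc-injective e)
... | X , toList-X = a ∷ X , cong (a ∷_) toList-X

sortDesc-↭ : ∀ {m} (r : Vec ℤ m) → sortDesc r ↭ toList r
sortDesc-↭ r = ↭-trans (PermP.↭-reverse _) (sort-↭ (toList r))

sortDesc-length : ∀ {m} (r : Vec ℤ m) → length (sortDesc r) ≡ m
sortDesc-length r = trans (PermP.↭-length (sortDesc-↭ r)) (VecP.length-toList r)

desc : ∀ {m} → Vec ℤ m → Vec ℤ m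
desc {m} r = proj₁ (listToVec (sortDesc r) m (sortDesc-length r))

toList-desc : ∀ {m} (r : Vec ℤ m) → toList (desc r) ≡ sortDesc r
toList-desc {m} r = proj₂ (listToVec (sortDesc r) m (sortDesc-length r))

desc-↭ : ∀ {m} (r : Vec ℤ m) → toList (desc r) ↭ toList r
desc-↭ r = subst (_↭ toList r) (sym (toList-desc r)) (sortDesc-↭ r)

desc-nonincreasing : ∀ {m} (r : Vec ℤ m) → Nonincreasing (desc r)
desc-nonincreasing r = subst (AllPairs _) (sym (toList-desc r))
  (AllPairs-reverse (LinkedP.Linked⇒AllPairs ℤP.≤-trans (sort-↗ (toList r))))

desc-parity : ∀ {m n} (r : Vec ℤ m) → AllSameParity n r → AllSameParity n (desc r)
desc-parity {n = n} r pr i = subst (SameParity n) (sym (VecAnyP.lookup-index r∋x)) (pr (VecAny.index r∋x))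
  where
  r∋x = ∈-toList⁻ (PermP.∈-resp-↭ (desc-↭ r) (∈-toList⁺ (∈-lookup i (desc r))))

desc-sum : ∀ {m} (r : Vec ℤ m) → lsum (toList (desc r)) ≡ vsum r
desc-sum r = trans (lsum-↭ (desc-↭ r)) (sym (vsum≡lsum r))

prefix-sums⇒Dominated : ∀ {m} c (x y : Vec ℤ m) →
  (∀ k → 1 ℕ.≤ k → k ℕ.≤ m → lsum (List.take k (toList y)) ≤ c + lsum (List.take k (toList x))) →
  c + lsum (toList x) ≡ lsum (toList y) → Dominated c x y
prefix-sums⇒Dominated c []      []      _        total = trans (sym (ℤP.+-identityʳ c)) total
prefix-sums⇒Dominated c (a ∷ x) (b ∷ y) prefix≤ total =
  first , prefix-sums⇒Dominated (c + (a - b)) x y prefix≤′ total′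
  where
  first : + 0 ≤ c + (a - b)
  first = subst (+ 0 ≤_) (regroup₁ c a b) (ℤP.i≤j⇒0≤j-i (prefix≤ 1 (s≤s z≤n) (s≤s z≤n)))
    where
    regroup₁ : ∀ c a b → (c + (a + + 0)) - (b + + 0) ≡ c + (a - b)
    regroup₁ = solve-∀
  prefix≤′ : ∀ k → 1 ℕ.≤ k → k ℕ.≤ _ →
    lsum (List.take k (toList y)) ≤ (c + (a - b)) + lsum (List.take k (toList x))
  prefix≤′ k _ k≤m = ≤-by-difference _ (ℤP.i≤j⇒0≤j-i (prefix≤ (suc k) (s≤s z≤n) (s≤s k≤m)))
                       (regroup₂ c a b (lsum (List.take k (toList x))) (lsum (List.take k (toList y))))
    where
    regroup₂ : ∀ c a b X Y → (c + (a - b)) + X ≡ Y + ((c + (a + X)) - (b + Y))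
    regroup₂ = solve-∀
  total′ : (c + (a - b)) + lsum (toList x) ≡ lsum (toList y)
  total′ = trans (regroup₃ c a b (lsum (toList x))) (trans (cong (_- b) total) (cancel b (lsum (toList y))))
    where
    regroup₃ : ∀ c a b X → (c + (a - b)) + X ≡ (c + (a + X)) - b
    regroup₃ = solve-∀
    cancel : ∀ b Y → (b + Y) - b ≡ Y
    cancel = solve-∀

majorization⇒Dominated : ∀ {m} (r r′ : Vec ℤ m) → r′ ≽ r → Dominated (+ 0) (desc r′) (desc r)
majorization⇒Dominated r r′ (same-total , prefix≤) =
  prefix-sums⇒Dominated (+ 0) (desc r′) (desc r)
    (λ k 1≤k k≤m → subst₂ (λ Y X → lsum (List.take k Y) ≤ + 0 + lsum (List.take k X))
                     (sym (toList-desc r)) (sym (toList-desc r′))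
                     (subst (_ ≤_) (sym (ℤP.+-identityˡ _)) (prefix≤ k 1≤k k≤m)))
    (trans (ℤP.+-identityˡ _) (trans (desc-sum r′) (trans same-total (sym (desc-sum r)))))

theorem6 : (m n : ℕ) → 1 ℕ.≤ m → 1 ℕ.≤ n → (r r′ : Vec ℤ m) →
    (∀ (i : Fin m) → + 2 ∣ (lookup r i - + n)) →
    (∀ (i : Fin m) → + 2 ∣ (lookup r′ i - + n)) →
    r′ ≽ r →
    cardA m n r′ ℕ.≤ cardA m n r
theorem6 m n _ _ r r′ r-parity r′-parity r′≽r = begin
  cardA m n r′         ≡⟨ card-↭ r′ (desc r′) (↭-sym (desc-↭ r′)) ⟩
  cardA m n (desc r′)  ≤⟨ descent _ (desc r′) (desc r) (ℕP.n<1+n _) (majorization⇒Dominated r r′ r′≽r)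
                            (desc-parity r′ r′-parity) (desc-parity r r-parity) (desc-nonincreasing r) ⟩
  cardA m n (desc r)   ≡⟨ card-↭ (desc r) r (desc-↭ r) ⟩
  cardA m n r          ∎
  where open ℕP.≤-Reasoning
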